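{- If $H$ and $G$ are 2-symmetric graphs, then $\operatorname{inflate}(G,H)$ is also 2-symmetric.
   Context: All graphs are finite simple graphs. A graph on $n$ vertices is 2-symmetric if either $n<2$, or $n\ge 2$ and exactly half of its $\binom{n}{2}$ vertex pairs are edges (edge density $1/2$). The inflation $\operatorname{inflate}(G,H)$ is the graph with vertex set $V(G)\times V(H)$ in which $(u,a)$ and $(v,b)$ are adjacent iff either $u=v$ and $ab\in E(H)$, or $uv\in E(G)$. -}

module Defs where

open import Data.Nat using (ℕ; zero; suc; _+_; _*_; _<_; _≥_)
open import Data.Nat.Combinatorics using (_C_)
open import Data.Bool using (Bool; true; false; _∨_; _∧_)
open import Data.Fin using (Fin; toℕ; remQuot)
open import Data.Fin.Properties using (_≟_)
open import Data.List using (List; length; filter; allFin; concatMap)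
open import Data.Product using (_×_; _,_; proj₁; proj₂)
open import Data.Sum using (_⊎_)
open import Relation.Binary.PropositionalEquality using (_≡_)
open import Relation.Nullary using (¬_; does)
open import Relation.Nullary.Decidable using (⌊_⌋)
open import Relation.Unary using (Decidable)

record Graph (n : ℕ) : Set where
  field
    adj   : Fin n → Fin n → Bool
    sym   : ∀ i j → adj i j ≡ adj j i
    irrefl : ∀ i → adj i i ≡ false
open Graph public

pairs : (n : ℕ) → List (Fin n × Fin n)
pairs n = concatMap (λ i → filter (λ p → Data.Nat._<?_ (toℕ (proj₁ p)) (toℕ (proj₂ p)))
                                  (Data.List.map (λ j → (i , j)) (allFin n)))
                    (allFin n)

edgeCount : ∀ {n} → Graph n → ℕ
edgeCount {n} G = length (filter (λ p → adj G (proj₁ p) (proj₂ p) Data.Bool.≟ true) (pairs n))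

TwoSymmetric : ∀ {n} → Graph n → Set
TwoSymmetric {n} G = (n < 2) ⊎ ((n ≥ 2) × (2 * edgeCount G ≡ n C 2))

-- inflate(G,H): vertex set V(G) × V(H), encoded as Fin (n * m) via remQuot.
-- (u,a) ~ (v,b) iff (u = v and ab ∈ E(H)) or uv ∈ E(G).
inflAdj : ∀ {n m} → Graph n → Graph m → Fin n × Fin m → Fin n × Fin m → Bool
inflAdj G H (u , a) (v , b) = (⌊ u ≟ v ⌋ ∧ adj H a b) ∨ adj G u v

open import Relation.Binary.PropositionalEquality using (refl; cong₂; trans; cong)
open import Data.Bool.Properties using (∨-comm)
open import Relation.Nullary using (yes; no)

private
  eqb-sym : ∀ {n} (u v : Fin n) → ⌊ u ≟ v ⌋ ≡ ⌊ v ≟ u ⌋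
  eqb-sym u v with u ≟ v | v ≟ u
  ... | yes _ | yes _ = refl
  ... | no _  | no _  = refl
  ... | yes refl | no ¬p = Data.Empty.⊥-elim (¬p refl)
    where import Data.Empty
  ... | no ¬p | yes refl = Data.Empty.⊥-elim (¬p refl)
    where import Data.Empty

  eqb-refl : ∀ {n} (u : Fin n) → ⌊ u ≟ u ⌋ ≡ true
  eqb-refl u with u ≟ u
  ... | yes _ = refl
  ... | no ¬p = Data.Empty.⊥-elim (¬p refl)
    where import Data.Empty

inflate : ∀ {n m} → Graph n → Graph m → Graph (n * m)
inflate {n} {m} G H = record
  { adj = λ x y → inflAdj G H (remQuot m x) (remQuot m y)
  ; sym = λ x y → s (remQuot m x) (remQuot m y)
  ; irrefl = λ x → ir (remQuot m x)
  }
  where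
  s : ∀ p q → inflAdj G H p q ≡ inflAdj G H q p
  s (u , a) (v , b) = cong₂ _∨_ (cong₂ _∧_ (eqb-sym u v) (Graph.sym H a b)) (Graph.sym G u v)
  ir : ∀ p → inflAdj G H p p ≡ false
  ir (u , a) rewrite eqb-refl u | Graph.irrefl H a | Graph.irrefl G u = refl

-- Count ordered adjacent pairs ("arcs"): a graph with e edges has 2e arcs, so 2-symmetry of a
-- graph on n vertices says that it has exactly C(n,2) arcs. In inflate(G,H) the pair
-- ((u,a),(v,b)) is an arc iff u = v and ab is an arc of H, or uv is an arc of G; hence
-- arcs(inflate G H) = n·arcs(H) + m²·arcs(G) = n·C(m,2) + m²·C(n,2), and this equals
-- C(nm,2) because 2·C(k,2) + k = k².
module Submission where

open import Defs hiding (sym)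

open import Data.Bool using (Bool; true; false)
import Data.Bool.Properties as Bool
open import Data.Fin using (Fin; zero; suc; toℕ; combine; remQuot; _↑ˡ_; _↑ʳ_)
open import Data.Fin.Properties using (_≟_; suc-injective; remQuot-combine; <-cmp)
open import Data.List using (List; []; _∷_; length; filter; concatMap; tabulate; allFin)
import Data.List as List
open import Data.List.Properties using (filter-++; length-++; map-tabulate)
open import Data.Nat using (ℕ; zero; suc; _+_; _*_; _<_; _<?_; s≤s; z≤n)
open import Data.Nat.Combinatorics using (_C_; nC1≡n; nCk+nC[k+1]≡[n+1]C[k+1])
open import Data.Nat.ListAction using () renaming (sum to sumˡ)
open import Data.Nat.Properties
  using (+-*-semiring; +-assoc; +-identityʳ; <-irrefl; ≮⇒≥; *-cancelˡ-≡; +-cancelʳ-≡)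
open import Data.Nat.Solver using (module +-*-Solver)
open import Data.Product using (_×_; _,_; proj₁; proj₂)
open import Data.Sum using (inj₁; inj₂)
open import Level using (0ℓ)
open import Relation.Binary using (tri<; tri≈; tri>)
open import Relation.Binary.PropositionalEquality
open import Relation.Nullary using (does; yes; no)
open import Relation.Nullary.Decidable using (⌊_⌋; ⌊⌋-map′; dec-true; dec-false)
open import Relation.Unary using (Pred; Decidable)

open import Algebra.Properties.Semiring.Sum +-*-semiring
open +-*-Solver using (solve; _:+_; _:*_; con; _:=_)
open ≡-Reasoning

𝟙 : Bool → ℕ
𝟙 true  = 1
𝟙 false = 0

∑-const : ∀ n c → ∑[ i < n ] c ≡ n * c
∑-const zero    c = refl
∑-const (suc n) c = cong (c +_) (∑-const n c)

∑-split : ∀ m k (f : Fin (m + k) → ℕ) →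
  ∑[ x < m + k ] f x ≡ ∑[ i < m ] f (i ↑ˡ k) + ∑[ j < k ] f (m ↑ʳ j)
∑-split zero    k f = refl
∑-split (suc m) k f =
  trans (cong (f zero +_) (∑-split m k (λ x → f (suc x)))) (sym (+-assoc (f zero) _ _))

∑-combine : ∀ n m (f : Fin (n * m) → ℕ) →
  ∑[ x < n * m ] f x ≡ ∑[ u < n ] ∑[ a < m ] f (combine u a)
∑-combine zero    m f = refl
∑-combine (suc n) m f =
  trans (∑-split m (n * m) f)
        (cong (∑[ a < m ] f (combine {suc n} zero a) +_) (∑-combine n m (λ x → f (m ↑ʳ x))))

∑-select : ∀ {n} (u : Fin n) (f : Fin n → ℕ) → ∑[ v < n ] (𝟙 ⌊ u ≟ v ⌋ * f v) ≡ f u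
∑-select {suc n} zero f = trans (cong₂ _+_ (+-identityʳ (f _)) (sum-replicate-zero n)) (+-identityʳ (f _))
∑-select {suc n} (suc u) f =
  trans (sum-cong-≗ (λ v → cong (λ b → 𝟙 b * f (suc v)) (⌊⌋-map′ (cong suc) suc-injective (u ≟ v))))
        (∑-select u (λ v → f (suc v)))

module _ {A : Set} where

  length-filter-concatMap : ∀ {B : Set} {P : Pred B 0ℓ} (P? : Decidable P) (f : A → List B) xs →
    length (filter P? (concatMap f xs)) ≡ sumˡ (List.map (λ x → length (filter P? (f x))) xs)
  length-filter-concatMap P? f []       = refl
  length-filter-concatMap P? f (x ∷ xs) = begin
    length (filter P? (f x List.++ concatMap f xs))
      ≡⟨ cong length (filter-++ P? (f x) (concatMap f xs)) ⟩
    length (filter P? (f x) List.++ filter P? (concatMap f xs))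
      ≡⟨ length-++ (filter P? (f x)) ⟩
    length (filter P? (f x)) + length (filter P? (concatMap f xs))
      ≡⟨ cong (length (filter P? (f x)) +_) (length-filter-concatMap P? f xs) ⟩
    length (filter P? (f x)) + sumˡ (List.map (λ x → length (filter P? (f x))) xs) ∎

  length-filter-filter : ∀ {P Q : Pred A 0ℓ} (P? : Decidable P) (Q? : Decidable Q) xs →
    length (filter P? (filter Q? xs)) ≡ sumˡ (List.map (λ x → 𝟙 (does (Q? x)) * 𝟙 (does (P? x))) xs)
  length-filter-filter P? Q? []       = refl
  length-filter-filter P? Q? (x ∷ xs) with does (Q? x)
  ... | false = length-filter-filter P? Q? xs
  ... | true with does (P? x)
  ...   | false = length-filter-filter P? Q? xs
  ...   | true  = cong suc (length-filter-filter P? Q? xs)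

  sum-map-tabulate : ∀ {n} (f : Fin n → A) (h : A → ℕ) →
    sumˡ (List.map h (tabulate f)) ≡ ∑[ i < n ] h (f i)
  sum-map-tabulate {zero}  f h = refl
  sum-map-tabulate {suc n} f h = cong (h (f zero) +_) (sum-map-tabulate (λ i → f (suc i)) h)

does-≟-true : ∀ b → does (b Bool.≟ true) ≡ b
does-≟-true true  = refl
does-≟-true false = refl

_<ᶠ_ : ∀ {n} → Fin n → Fin n → Bool
i <ᶠ j = does (toℕ i <? toℕ j)

arcCount : ∀ {n} → Graph n → ℕ
arcCount {n} G = ∑[ i < n ] ∑[ j < n ] 𝟙 (adj G i j)

edgeCount≡∑< : ∀ {n} (G : Graph n) → edgeCount G ≡ ∑[ i < n ] ∑[ j < n ] (𝟙 (i <ᶠ j) * 𝟙 (adj G i j))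
edgeCount≡∑< {n} G = begin
  edgeCount G
    ≡⟨ length-filter-concatMap isEdge? row (allFin n) ⟩
  sumˡ (List.map rowEdges (allFin n))
    ≡⟨ sum-map-tabulate (λ i → i) rowEdges ⟩
  ∑[ i < n ] rowEdges i
    ≡⟨ sum-cong-≗ rowEdges≡∑ ⟩
  ∑[ i < n ] ∑[ j < n ] (𝟙 (i <ᶠ j) * 𝟙 (adj G i j)) ∎
  where
  Pair = Fin n × Fin n
  isEdge? : Decidable (λ (p : Pair) → adj G (proj₁ p) (proj₂ p) ≡ true)
  isEdge? (i , j) = adj G i j Bool.≟ true
  isOrdered? : Decidable (λ (p : Pair) → toℕ (proj₁ p) < toℕ (proj₂ p))
  isOrdered? (i , j) = toℕ i <? toℕ j
  row : Fin n → List Pair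
  row i = filter isOrdered? (List.map (i ,_) (allFin n))
  rowEdges : Fin n → ℕ
  rowEdges i = length (filter isEdge? (row i))
  weight : Pair → ℕ
  weight p = 𝟙 (does (isOrdered? p)) * 𝟙 (does (isEdge? p))
  rowEdges≡∑ : ∀ i → rowEdges i ≡ ∑[ j < n ] (𝟙 (i <ᶠ j) * 𝟙 (adj G i j))
  rowEdges≡∑ i = begin
    rowEdges i
      ≡⟨ length-filter-filter isEdge? isOrdered? (List.map (i ,_) (allFin n)) ⟩
    sumˡ (List.map weight (List.map (i ,_) (allFin n)))
      ≡⟨ cong (λ ps → sumˡ (List.map weight ps)) (map-tabulate (λ j → j) (i ,_)) ⟩
    sumˡ (List.map weight (tabulate (i ,_)))
      ≡⟨ sum-map-tabulate (i ,_) weight ⟩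
    ∑[ j < n ] weight (i , j)
      ≡⟨ sum-cong-≗ (λ j → cong (λ b → 𝟙 (i <ᶠ j) * 𝟙 b) (does-≟-true (adj G i j))) ⟩
    ∑[ j < n ] (𝟙 (i <ᶠ j) * 𝟙 (adj G i j)) ∎

adj≡<ᶠ-split : ∀ {n} (G : Graph n) i j →
  𝟙 (adj G i j) ≡ 𝟙 (i <ᶠ j) * 𝟙 (adj G i j) + 𝟙 (j <ᶠ i) * 𝟙 (adj G j i)
adj≡<ᶠ-split G i j with <-cmp i j
... | tri< i<j _ j≮i rewrite dec-true (toℕ i <? toℕ j) i<j | dec-false (toℕ j <? toℕ i) j≮i =
  sym (trans (+-identityʳ _) (+-identityʳ _))
... | tri≈ _ refl _ rewrite dec-false (toℕ i <? toℕ i) (<-irrefl refl) | Graph.irrefl G i = refl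
... | tri> i≮j _ j<i rewrite dec-false (toℕ i <? toℕ j) i≮j | dec-true (toℕ j <? toℕ i) j<i | Graph.sym G i j =
  sym (+-identityʳ _)

arcCount≡2*edgeCount : ∀ {n} (G : Graph n) → arcCount G ≡ 2 * edgeCount G
arcCount≡2*edgeCount {n} G = begin
  arcCount G                                                   ≡⟨ sum-cong-≗ (λ i → sum-cong-≗ (adj≡<ᶠ-split G i)) ⟩
  ∑[ i < n ] ∑[ j < n ] (forward i j + forward j i)            ≡⟨ sum-cong-≗ (λ i → ∑-distrib-+ (forward i) (λ j → forward j i)) ⟩
  ∑[ i < n ] (∑[ j < n ] forward i j + ∑[ j < n ] forward j i) ≡⟨ ∑-distrib-+ (λ i → ∑[ j < n ] forward i j) _ ⟩
  e + ∑[ i < n ] ∑[ j < n ] forward j i                        ≡⟨ cong (e +_) (∑-comm (λ i j → forward j i)) ⟩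
  e + e                                                        ≡⟨ cong (e +_) (sym (+-identityʳ e)) ⟩
  2 * e                                                        ≡⟨ cong (2 *_) (sym (edgeCount≡∑< G)) ⟩
  2 * edgeCount G                                              ∎
  where
  forward : Fin n → Fin n → ℕ
  forward i j = 𝟙 (i <ᶠ j) * 𝟙 (adj G i j)
  e = ∑[ i < n ] ∑[ j < n ] forward i j

𝟙-inflAdj : ∀ {n m} (G : Graph n) (H : Graph m) u a v b →
  𝟙 (inflAdj G H (u , a) (v , b)) ≡ 𝟙 ⌊ u ≟ v ⌋ * 𝟙 (adj H a b) + 𝟙 (adj G u v)
𝟙-inflAdj G H u a v b with u ≟ v
... | no _ = refl
... | yes refl rewrite Graph.irrefl G u with adj H a b
...   | true  = refl
...   | false = refl

∑∑-combine : ∀ n m (f : Fin (n * m) → Fin (n * m) → ℕ) →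
  ∑[ x < n * m ] ∑[ y < n * m ] f x y
    ≡ ∑[ u < n ] ∑[ a < m ] ∑[ v < n ] ∑[ b < m ] f (combine u a) (combine v b)
∑∑-combine n m f =
  trans (∑-combine n m (λ x → ∑[ y < n * m ] f x y))
        (sum-cong-≗ (λ u → sum-cong-≗ (λ a → ∑-combine n m (f (combine {n} {m} u a)))))

arcCount-inflate : ∀ {n m} (G : Graph n) (H : Graph m) →
  arcCount (inflate G H) ≡ n * arcCount H + m * (m * arcCount G)
arcCount-inflate {n} {m} G H = begin
  arcCount (inflate G H)
    ≡⟨ ∑∑-combine n m (λ x y → 𝟙 (inflAdj G H (remQuot m x) (remQuot m y))) ⟩
  ∑[ u < n ] ∑[ a < m ] ∑[ v < n ] ∑[ b < m ]
    𝟙 (inflAdj G H (remQuot m (combine u a)) (remQuot m (combine v b)))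
    ≡⟨ sum-cong-≗ (λ u → sum-cong-≗ (λ a → sum-cong-≗ (λ v → sum-cong-≗ (λ b →
         cong₂ (λ p q → 𝟙 (inflAdj G H p q)) (remQuot-combine u a) (remQuot-combine v b))))) ⟩
  ∑[ u < n ] ∑[ a < m ] ∑[ v < n ] ∑[ b < m ] 𝟙 (inflAdj G H (u , a) (v , b))
    ≡⟨ sum-cong-≗ (λ u → sum-cong-≗ (λ a → sum-cong-≗ (λ v → sum-cong-≗ (𝟙-inflAdj G H u a v)))) ⟩
  ∑[ u < n ] ∑[ a < m ] ∑[ v < n ] ∑[ b < m ] (δ u v * h a b + g u v)
    ≡⟨ sum-cong-≗ (λ u → sum-cong-≗ (λ a → sum-cong-≗ (λ v →
         trans (∑-distrib-+ (λ b → δ u v * h a b) (λ _ → g u v))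
               (cong₂ _+_ (sym (*-distribˡ-sum (δ u v) (h a))) (∑-const m (g u v)))))) ⟩
  ∑[ u < n ] ∑[ a < m ] ∑[ v < n ] (δ u v * outH a + m * g u v)
    ≡⟨ sum-cong-≗ (λ u → sum-cong-≗ (λ a →
         trans (∑-distrib-+ (λ v → δ u v * outH a) (λ v → m * g u v))
               (cong₂ _+_ (∑-select u (λ _ → outH a)) (sym (*-distribˡ-sum m (g u)))))) ⟩
  ∑[ u < n ] ∑[ a < m ] (outH a + m * outG u)
    ≡⟨ sum-cong-≗ (λ u → trans (∑-distrib-+ outH (λ _ → m * outG u))
                                (cong (arcCount H +_) (∑-const m (m * outG u)))) ⟩
  ∑[ u < n ] (arcCount H + m * (m * outG u))
    ≡⟨ trans (∑-distrib-+ (λ _ → arcCount H) (λ u → m * (m * outG u)))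
             (cong₂ _+_ (∑-const n (arcCount H))
                        (trans (sym (*-distribˡ-sum m (λ u → m * outG u)))
                               (cong (m *_) (sym (*-distribˡ-sum m outG))))) ⟩
  n * arcCount H + m * (m * arcCount G) ∎
  where
  δ : Fin n → Fin n → ℕ
  δ u v = 𝟙 ⌊ u ≟ v ⌋
  g : Fin n → Fin n → ℕ
  g u v = 𝟙 (adj G u v)
  h : Fin m → Fin m → ℕ
  h a b = 𝟙 (adj H a b)
  outG : Fin n → ℕ
  outG u = ∑[ v < n ] g u v
  outH : Fin m → ℕ
  outH a = ∑[ b < m ] h a b

2*nC2+n≡n*n : ∀ n → 2 * (n C 2) + n ≡ n * n
2*nC2+n≡n*n zero    = refl
2*nC2+n≡n*n (suc n) = begin
  2 * (suc n C 2) + suc n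
    ≡⟨ cong (λ c → 2 * c + suc n) (sym (nCk+nC[k+1]≡[n+1]C[k+1] n 1)) ⟩
  2 * (n C 1 + n C 2) + suc n
    ≡⟨ cong (λ c → 2 * (c + n C 2) + suc n) (nC1≡n n) ⟩
  2 * (n + n C 2) + suc n
    ≡⟨ solve 2 (λ n c → con 2 :* (n :+ c) :+ (con 1 :+ n)
                       := (con 2 :* c :+ n) :+ (con 1 :+ con 2 :* n)) refl n (n C 2) ⟩
  (2 * (n C 2) + n) + (1 + 2 * n)
    ≡⟨ cong (_+ (1 + 2 * n)) (2*nC2+n≡n*n n) ⟩
  n * n + (1 + 2 * n)
    ≡⟨ solve 1 (λ n → n :* n :+ (con 1 :+ con 2 :* n) := (con 1 :+ n) :* (con 1 :+ n)) refl n ⟩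
  suc n * suc n ∎

n*mC2+m*[m*nC2]≡[n*m]C2 : ∀ n m → n * (m C 2) + m * (m * (n C 2)) ≡ (n * m) C 2
n*mC2+m*[m*nC2]≡[n*m]C2 n m = *-cancelˡ-≡ _ _ 2 (+-cancelʳ-≡ (n * m) _ _ (begin
  2 * (n * c + m * (m * d)) + n * m
    ≡⟨ solve 4 (λ n m c d → con 2 :* (n :* c :+ m :* (m :* d)) :+ n :* m
                           := n :* (con 2 :* c :+ m) :+ m :* m :* (con 2 :* d)) refl n m c d ⟩
  n * (2 * c + m) + m * m * (2 * d)
    ≡⟨ cong (λ x → n * x + m * m * (2 * d)) (2*nC2+n≡n*n m) ⟩
  n * (m * m) + m * m * (2 * d)
    ≡⟨ solve 3 (λ n m d → n :* (m :* m) :+ m :* m :* (con 2 :* d)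
                         := m :* m :* (con 2 :* d :+ n)) refl n m d ⟩
  m * m * (2 * d + n)
    ≡⟨ cong (m * m *_) (2*nC2+n≡n*n n) ⟩
  m * m * (n * n)
    ≡⟨ solve 2 (λ n m → m :* m :* (n :* n) := (n :* m) :* (n :* m)) refl n m ⟩
  (n * m) * (n * m)
    ≡⟨ sym (2*nC2+n≡n*n (n * m)) ⟩
  2 * ((n * m) C 2) + n * m ∎))
  where
  c = m C 2
  d = n C 2

twoSymmetric⇒arcCount≡nC2 : ∀ {n} (G : Graph n) → TwoSymmetric G → arcCount G ≡ n C 2
-- For n < 2 there are no vertex pairs, so 2 * edgeCount G computes to 0 = n C 2.
twoSymmetric⇒arcCount≡nC2 G (inj₁ (s≤s z≤n))       = arcCount≡2*edgeCount G
twoSymmetric⇒arcCount≡nC2 G (inj₁ (s≤s (s≤s z≤n))) = arcCount≡2*edgeCount G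
twoSymmetric⇒arcCount≡nC2 G (inj₂ (_ , 2e≡nC2))    = trans (arcCount≡2*edgeCount G) 2e≡nC2

arcCount≡nC2⇒twoSymmetric : ∀ {n} (G : Graph n) → arcCount G ≡ n C 2 → TwoSymmetric G
arcCount≡nC2⇒twoSymmetric {n} G arcs≡nC2 with n <? 2
... | yes n<2 = inj₁ n<2
... | no  n≮2 = inj₂ (≮⇒≥ n≮2 , trans (sym (arcCount≡2*edgeCount G)) arcs≡nC2)

mainTheorem10 : ∀ {n m : ℕ} (G : Graph n) (H : Graph m) →
    TwoSymmetric H → TwoSymmetric G → TwoSymmetric (inflate G H)
mainTheorem10 {n} {m} G H tH tG = arcCount≡nC2⇒twoSymmetric (inflate G H) (begin
  arcCount (inflate G H)                ≡⟨ arcCount-inflate G H ⟩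
  n * arcCount H + m * (m * arcCount G) ≡⟨ cong₂ (λ x y → n * x + m * (m * y))
                                                  (twoSymmetric⇒arcCount≡nC2 H tH)
                                                  (twoSymmetric⇒arcCount≡nC2 G tG) ⟩
  n * (m C 2) + m * (m * (n C 2))       ≡⟨ n*mC2+m*[m*nC2]≡[n*m]C2 n m ⟩
  (n * m) C 2                           ∎)
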